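{- For each integer $\ell \geqslant 0$, the relation $\sim_\ell$ is an equivalence relation on the class of $\ell$-finite graphs. Each $\ell$-equivalence class contains a unique (up to isomorphism) $\ell$-minimal graph, and this graph is isomorphic to an induced subgraph of every graph in its class.
   Context: All graphs are undirected and loopless; they may contain parallel edges and may be infinite. For an integer $\ell \geqslant 0$, an $\ell$-link of a graph $G$ is a walk $[v_0, e_1, v_1, \ldots, e_\ell, v_\ell]$ of length $\ell$ in which consecutive edges are different; a walk and its reverse are the same $\ell$-link. The $\ell$-link graph $\mathbb{L}_\ell(G)$ has as vertices the $\ell$-links of $G$, and for every $(\ell+1)$-link $[v_0, e_1, \ldots, e_{\ell+1}, v_{\ell+1}]$ of $G$ one edge joining $[v_0, e_1, \ldots, e_\ell, v_\ell]$ and $[v_1, e_2, \ldots, e_{\ell+1}, v_{\ell+1}]$. A graph is $\ell$-finite if its $\ell$-link graph is finite. Two $\ell$-finite graphs $X, Y$ are $\ell$-equivalent, $X \sim_\ell Y$, if there is a graph $Z$ isomorphic to a subgraph of $X$ and to a subgraph of $Y$ with $\mathbb{L}_\ell(X) \cong \mathbb{L}_\ell(Y) \cong \mathbb{L}_\ell(Z)$. An $\ell$-finite graph $X$ is $\ell$-minimal if $X$ is null (no vertices) or, for every graph $Y$ isomorphic to a proper subgraph of $X$, $\mathbb{L}_\ell(Y)$ is isomorphic to a proper subgraph of $\mathbb{L}_\ell(X)$. -}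

module Defs where

open import Level using (0ℓ)
open import Data.Nat using (ℕ; zero; suc)
open import Data.Fin using (Fin; zero; suc; inject₁; opposite; toℕ)
open import Data.Fin.Properties using (toℕ-inject₁)
open import Data.Product using (Σ; ∃; _×_; _,_; proj₁; proj₂)
open import Data.Sum using (_⊎_; inj₁; inj₂)
open import Data.Empty using (⊥)
open import Relation.Nullary using (¬_)
open import Relation.Binary.PropositionalEquality using (_≡_; _≢_; refl; sym; trans; cong)

-- An edge e has two end-vertices ends e; the
-- order of the pair carries no meaning (all notions below treat it as an
-- unordered pair).

record Graph : Set₁ where
  field
    V      : Set
    E      : Set
    ends   : E → V × V
    noLoop : ∀ e → proj₁ (ends e) ≢ proj₂ (ends e)
open Graph public

Joins : (G : Graph) → E G → V G → V G → Set
Joins G e a b = ends G e ≡ (a , b) ⊎ ends G e ≡ (b , a)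

-- Walks of length ℓ without immediate reversal of an edge (consecutive
-- edges different):  vs i = v_i (i = 0..ℓ), es i = e_{i+1} (i = 0..ℓ-1).

record Walk (G : Graph) (ℓ : ℕ) : Set where
  field
    vs    : Fin (suc ℓ) → V G
    es    : Fin ℓ → E G
    joins : ∀ i → Joins G (es i) (vs (inject₁ i)) (vs (suc i))
    nobt  : ∀ (i j : Fin ℓ) → toℕ j ≡ suc (toℕ i) → es i ≢ es j
open Walk public

-- An ℓ-link is a walk up to reversal: two walks are the same ℓ-link iff
-- they agree pointwise, or one is pointwise the reverse of the other.
LinkEq : (G : Graph) (ℓ : ℕ) → Walk G ℓ → Walk G ℓ → Set
LinkEq G ℓ w w' =
  ((∀ i → vs w i ≡ vs w' i) × (∀ i → es w i ≡ es w' i)) ⊎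
  ((∀ i → vs w i ≡ vs w' (opposite i)) × (∀ i → es w i ≡ es w' (opposite i)))

prefix : {G : Graph} {ℓ : ℕ} → Walk G (suc ℓ) → Walk G ℓ
prefix {G} {ℓ} w = record
  { vs = λ i → vs w (inject₁ i)
  ; es = λ i → es w (inject₁ i)
  ; joins = λ i → joins w (inject₁ i)
  ; nobt = λ i j p → nobt w (inject₁ i) (inject₁ j)
                       (trans (toℕ-inject₁ j) (trans p (cong suc (sym (toℕ-inject₁ i)))))
  }

suffix : {G : Graph} {ℓ : ℕ} → Walk G (suc ℓ) → Walk G ℓ
suffix w = record
  { vs = λ i → vs w (suc i)
  ; es = λ i → es w (suc i)
  ; joins = λ i → joins w (suc i)
  ; nobt = λ i j p → nobt w (suc i) (suc j) (cong suc p)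
  }

-- Graphs whose vertex and edge sets carry an equality relation (needed
-- because ℓ-links are walks modulo reversal; no quotient types).

record SGraph : Set₁ where
  field
    SV    : Set
    SE    : Set
    _≈V_  : SV → SV → Set
    _≈E_  : SE → SE → Set
    sends : SE → SV × SV
open SGraph public

toS : Graph → SGraph
toS G = record { SV = V G ; SE = E G ; _≈V_ = _≡_ ; _≈E_ = _≡_ ; sends = ends G }

-- The ℓ-link graph 𝕃_ℓ(G): vertices the ℓ-links, one edge per
-- (ℓ+1)-link, joining its prefix and suffix.
Link : ℕ → Graph → SGraph
Link ℓ G = record
  { SV = Walk G ℓ
  ; SE = Walk G (suc ℓ)
  ; _≈V_ = LinkEq G ℓ
  ; _≈E_ = LinkEq G (suc ℓ)
  ; sends = λ w → (prefix w , suffix w)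
  }

UEq : (H : SGraph) → SV H × SV H → SV H × SV H → Set
UEq H (a , b) (c , d) = (_≈V_ H a c × _≈V_ H b d) ⊎ (_≈V_ H a d × _≈V_ H b c)

record Embedding (G H : SGraph) : Set where
  field
    fV    : SV G → SV H
    fE    : SE G → SE H
    fV-cong : ∀ {x y} → _≈V_ G x y → _≈V_ H (fV x) (fV y)
    fE-cong : ∀ {x y} → _≈E_ G x y → _≈E_ H (fE x) (fE y)
    fV-inj  : ∀ {x y} → _≈V_ H (fV x) (fV y) → _≈V_ G x y
    fE-inj  : ∀ {x y} → _≈E_ H (fE x) (fE y) → _≈E_ G x y
    inc   : ∀ e → UEq H (sends H (fE e)) (fV (proj₁ (sends G e)) , fV (proj₂ (sends G e)))
open Embedding public

ProperEmbedding : SGraph → SGraph → Set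
ProperEmbedding G H = Σ (Embedding G H) λ f →
  (∃ λ y → ∀ x → ¬ _≈V_ H (fV f x) y) ⊎ (∃ λ d → ∀ e → ¬ _≈E_ H (fE f e) d)

Iso : SGraph → SGraph → Set
Iso G H = Σ (Embedding G H) λ f →
  (∀ y → ∃ λ x → _≈V_ H (fV f x) y) × (∀ d → ∃ λ e → _≈E_ H (fE f e) d)

InducedEmbedding : SGraph → SGraph → Set
InducedEmbedding G H = Σ (Embedding G H) λ f →
  ∀ d a b → UEq H (sends H d) (fV f a , fV f b) → ∃ λ e → _≈E_ H (fE f e) d

_≅_ : Graph → Graph → Set
X ≅ Y = Iso (toS X) (toS Y)

FiniteS : (A : Set) → (A → A → Set) → Set
FiniteS A _≈_ = ∃ λ n → Σ (Fin n → A) λ f →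
  (∀ i j → f i ≈ f j → i ≡ j) × (∀ x → ∃ λ i → f i ≈ x)

LFinite : ℕ → Graph → Set
LFinite ℓ X = FiniteS (SV (Link ℓ X)) (_≈V_ (Link ℓ X)) ×
              FiniteS (SE (Link ℓ X)) (_≈E_ (Link ℓ X))

LEquiv : ℕ → Graph → Graph → Set₁
LEquiv ℓ X Y = Σ Graph λ Z →
  Embedding (toS Z) (toS X) × Embedding (toS Z) (toS Y) ×
  Iso (Link ℓ X) (Link ℓ Z) × Iso (Link ℓ Y) (Link ℓ Z)

Null : Graph → Set
Null X = ¬ V X

LMinimal : ℕ → Graph → Set₁
LMinimal ℓ X = Null X ⊎
  (∀ (Y : Graph) → ProperEmbedding (toS Y) (toS X) →
     ProperEmbedding (Link ℓ Y) (Link ℓ X))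

module Submission where

-- Fix ℓ and call a vertex of G *linked* if it lies on an
-- ℓ-link.  The *core* of G is the subgraph induced by its linked vertices.
-- Every ℓ-link and (ℓ+1)-link of G lies in its core, so 𝕃_ℓ(G) ≅ 𝕃_ℓ(core G).
-- The combinatorial heart is that an edge d between two linked vertices u, v
-- lies on an ℓ- or (ℓ+1)-link: if the ℓ-links through u and v avoid d, each
-- contains a walk of at least half its length starting at u (resp. v), and
-- suitable pieces of these, joined along d, form an (ℓ+1)-link through d.
-- Consequently, if Z ⊆ X and every link of X comes from Z, then core Z ≅ core X.
-- When X ~ Y via Z, a pigeonhole argument on the finite link graphs (using
-- excluded middle) shows that every link of X and of Y comes from Z, so
-- ℓ-equivalent graphs have isomorphic cores.  The theorem follows: the core
-- of X is ℓ-minimal and equivalent to X, an ℓ-minimal graph is its own core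
-- (hence unique), and the core of every Y ~ X is an induced subgraph of Y.

open import Defs
open import Level using (0ℓ)
open import Data.Nat using (ℕ; zero; suc; _+_; _∸_; _≤_; _<_; z≤n; s≤s; z<s; _≤?_; _<?_)
open import Data.Nat.Properties
open import Data.Fin using (Fin; zero; suc; inject₁; opposite; toℕ; fromℕ<; punchOut)
open import Data.Fin.Properties
  using (toℕ-inject₁; toℕ-fromℕ<; fromℕ<-toℕ; toℕ<n; toℕ≤pred[n]; opposite-involutive;
         punchOut-injective; injective⇒≤)
open import Data.Bool using (T)
open import Data.Bool.Properties using (T-irrelevant)
open import Data.Product using (Σ; ∃; _×_; _,_; proj₁; proj₂)
open import Data.Sum using (_⊎_; inj₁; inj₂; [_,_])
open import Data.Empty using (⊥-elim)
open import Relation.Nullary using (¬_; Dec; yes; no)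
open import Relation.Nullary.Irrelevant using (Irrelevant)
open import Relation.Nullary.Decidable using (isYes; toWitness; fromWitness)
open import Relation.Binary.Definitions using (tri<; tri≈; tri>)
open import Relation.Binary.Structures using (IsEquivalence)
open import Relation.Binary.PropositionalEquality
  using (_≡_; _≢_; refl; sym; trans; cong; cong₂; subst; isEquivalence)
open import Axiom.ExcludedMiddle using (ExcludedMiddle)

module _ {G : Graph} {n : ℕ} where

  LinkEq-refl : (w : Walk G n) → LinkEq G n w w
  LinkEq-refl w = inj₁ ((λ _ → refl) , (λ _ → refl))

  LinkEq-sym : {w w' : Walk G n} → LinkEq G n w w' → LinkEq G n w' w
  LinkEq-sym (inj₁ (p , q)) = inj₁ ((λ i → sym (p i)) , (λ i → sym (q i)))
  LinkEq-sym {w} {w'} (inj₂ (p , q)) = inj₂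
    ( (λ i → trans (cong (vs w') (sym (opposite-involutive i))) (sym (p (opposite i))))
    , (λ i → trans (cong (es w') (sym (opposite-involutive i))) (sym (q (opposite i)))))

  LinkEq-trans : {w w' w'' : Walk G n} → LinkEq G n w w' → LinkEq G n w' w'' → LinkEq G n w w''
  LinkEq-trans (inj₁ (p , q)) (inj₁ (p' , q')) =
    inj₁ ((λ i → trans (p i) (p' i)) , (λ i → trans (q i) (q' i)))
  LinkEq-trans (inj₁ (p , q)) (inj₂ (p' , q')) =
    inj₂ ((λ i → trans (p i) (p' i)) , (λ i → trans (q i) (q' i)))
  LinkEq-trans (inj₂ (p , q)) (inj₁ (p' , q')) =
    inj₂ ((λ i → trans (p i) (p' (opposite i))) , (λ i → trans (q i) (q' (opposite i))))
  LinkEq-trans {w'' = w''} (inj₂ (p , q)) (inj₂ (p' , q')) = inj₁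
    ( (λ i → trans (p i) (trans (p' (opposite i)) (cong (vs w'') (opposite-involutive i))))
    , (λ i → trans (q i) (trans (q' (opposite i)) (cong (es w'') (opposite-involutive i)))))

  LinkEq-vertex : {u w : Walk G n} → LinkEq G n u w → ∀ i → ∃ λ k → vs u k ≡ vs w i
  LinkEq-vertex (inj₁ (p , _)) i = i , p i
  LinkEq-vertex {w = w} (inj₂ (p , _)) i =
    opposite i , trans (p (opposite i)) (cong (vs w) (opposite-involutive i))

  LinkEq-edge : {u w : Walk G n} → LinkEq G n u w → ∀ i → ∃ λ k → es u k ≡ es w i
  LinkEq-edge (inj₁ (_ , q)) i = i , q i
  LinkEq-edge {w = w} (inj₂ (_ , q)) i =
    opposite i , trans (q (opposite i)) (cong (es w) (opposite-involutive i))

LinkEq-map : {G H : Graph} {n : ℕ} {w w' : Walk G n} {u u' : Walk H n} →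
  (∀ i j → vs w i ≡ vs w' j → vs u i ≡ vs u' j) →
  (∀ i j → es w i ≡ es w' j → es u i ≡ es u' j) →
  LinkEq G n w w' → LinkEq H n u u'
LinkEq-map F K (inj₁ (p , q)) = inj₁ ((λ i → F i i (p i)) , (λ i → K i i (q i)))
LinkEq-map F K (inj₂ (p , q)) =
  inj₂ ((λ i → F i (opposite i) (p i)) , (λ i → K i (opposite i) (q i)))

LinkEq-isEquivalence : {G : Graph} {n : ℕ} → IsEquivalence (LinkEq G n)
LinkEq-isEquivalence {G} {n} = record
  { refl = λ {w} → LinkEq-refl w
  ; sym = λ {w w'} → LinkEq-sym {G} {n} {w} {w'}
  ; trans = λ {w w' w''} → LinkEq-trans {G} {n} {w} {w'} {w''} }

record IsSetoidGraph (H : SGraph) : Set where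
  field
    ≈V-equiv : IsEquivalence (_≈V_ H)
    ≈E-equiv : IsEquivalence (_≈E_ H)
  module ≈V = IsEquivalence ≈V-equiv
  module ≈E = IsEquivalence ≈E-equiv

plain-setoidGraph : (G : Graph) → IsSetoidGraph (toS G)
plain-setoidGraph G = record { ≈V-equiv = isEquivalence ; ≈E-equiv = isEquivalence }

link-setoidGraph : (ℓ : ℕ) (G : Graph) → IsSetoidGraph (Link ℓ G)
link-setoidGraph ℓ G = record { ≈V-equiv = LinkEq-isEquivalence ; ≈E-equiv = LinkEq-isEquivalence }

module _ {H : SGraph} (eH : IsSetoidGraph H) where
  open IsSetoidGraph eH

  UEq-trans : ∀ {p q r} → UEq H p q → UEq H q r → UEq H p r
  UEq-trans (inj₁ (a , b)) (inj₁ (c , d)) = inj₁ (≈V.trans a c , ≈V.trans b d)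
  UEq-trans (inj₁ (a , b)) (inj₂ (c , d)) = inj₂ (≈V.trans a c , ≈V.trans b d)
  UEq-trans (inj₂ (a , b)) (inj₁ (c , d)) = inj₂ (≈V.trans a d , ≈V.trans b c)
  UEq-trans (inj₂ (a , b)) (inj₂ (c , d)) = inj₁ (≈V.trans a d , ≈V.trans b c)

UEq-map : (H K : SGraph) (f : SV H → SV K) → (∀ {x y} → _≈V_ H x y → _≈V_ K (f x) (f y)) →
  ∀ {p q} → UEq H p q → UEq K (f (proj₁ p) , f (proj₂ p)) (f (proj₁ q) , f (proj₂ q))
UEq-map H K f f-cong (inj₁ (a , b)) = inj₁ (f-cong a , f-cong b)
UEq-map H K f f-cong (inj₂ (a , b)) = inj₂ (f-cong a , f-cong b)

module _ {H : SGraph} (eH : IsSetoidGraph H) where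
  open IsSetoidGraph eH

  idEmbedding : Embedding H H
  idEmbedding = record
    { fV = λ x → x ; fE = λ x → x ; fV-cong = λ p → p ; fE-cong = λ p → p
    ; fV-inj = λ p → p ; fE-inj = λ p → p ; inc = λ e → inj₁ (≈V.refl , ≈V.refl) }

  idIso : Iso H H
  idIso = idEmbedding , (λ y → y , ≈V.refl) , (λ d → d , ≈E.refl)

module _ {G H K : SGraph} (eK : IsSetoidGraph K) where
  open IsSetoidGraph eK

  compose : Embedding H K → Embedding G H → Embedding G K
  compose g f = record
    { fV = λ x → fV g (fV f x) ; fE = λ x → fE g (fE f x)
    ; fV-cong = λ p → fV-cong g (fV-cong f p) ; fE-cong = λ p → fE-cong g (fE-cong f p)
    ; fV-inj = λ p → fV-inj f (fV-inj g p) ; fE-inj = λ p → fE-inj f (fE-inj g p)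
    ; inc = λ e → UEq-trans eK (inc g (fE f e)) (UEq-map H K (fV g) (fV-cong g) (inc f e)) }

  composeIso : Iso H K → Iso G H → Iso G K
  composeIso (g , g-onV , g-onE) (f , f-onV , f-onE) = compose g f ,
    (λ y → let (x' , p) = g-onV y ; (x , q) = f-onV x' in x , ≈V.trans (fV-cong g q) p) ,
    (λ y → let (x' , p) = g-onE y ; (x , q) = f-onE x' in x , ≈E.trans (fE-cong g q) p)

Joins→UEq : {G : Graph} {e : E G} {a b : V G} → Joins G e a b → UEq (toS G) (ends G e) (a , b)
Joins→UEq (inj₁ refl) = inj₁ (refl , refl)
Joins→UEq (inj₂ refl) = inj₂ (refl , refl)

UEq→Joins : {G : Graph} {e : E G} {a b : V G} → UEq (toS G) (ends G e) (a , b) → Joins G e a b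
UEq→Joins (inj₁ (p , q)) = inj₁ (cong₂ _,_ p q)
UEq→Joins (inj₂ (p , q)) = inj₂ (cong₂ _,_ p q)

Joins-cong : {G : Graph} {e e' : E G} {a a' b b' : V G} → e ≡ e' → a ≡ a' → b ≡ b' →
  Joins G e a b → Joins G e' a' b'
Joins-cong refl refl refl J = J

Joins-sym : {G : Graph} {e : E G} {a b : V G} → Joins G e a b → Joins G e b a
Joins-sym (inj₁ p) = inj₂ p
Joins-sym (inj₂ p) = inj₁ p

Joins-ends : {G : Graph} {P : V G → Set} {e : E G} {a b : V G} →
  Joins G e a b → P a → P b → P (proj₁ (ends G e)) × P (proj₂ (ends G e))
Joins-ends (inj₁ refl) pa pb = pa , pb
Joins-ends (inj₂ refl) pa pb = pb , pa

Joins-ends-self : (G : Graph) (e : E G) → Joins G e (proj₁ (ends G e)) (proj₂ (ends G e))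
Joins-ends-self G e = inj₁ refl

Joins-map : {G H : Graph} (f : Embedding (toS G) (toS H)) {e : E G} {a b : V G} →
  Joins G e a b → Joins H (fE f e) (fV f a) (fV f b)
Joins-map {G} {H} f {e} J = UEq→Joins {H}
  (UEq-trans (plain-setoidGraph H) (inc f e) (UEq-map (toS G) (toS H) (fV f) (cong (fV f)) (Joins→UEq {G} J)))

mapWalk : {G H : Graph} {n : ℕ} → Embedding (toS G) (toS H) → Walk G n → Walk H n
mapWalk {G} {H} f w = record
  { vs = λ i → fV f (vs w i)
  ; es = λ i → fE f (es w i)
  ; joins = λ i → Joins-map {G} {H} f (joins w i)
  ; nobt = λ i j p eq → nobt w i j p (fE-inj f eq) }

linkEmbedding : {G H : Graph} (ℓ : ℕ) → Embedding (toS G) (toS H) → Embedding (Link ℓ G) (Link ℓ H)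
linkEmbedding {G} {H} ℓ f = record
  { fV = f* ; fE = f*
  ; fV-cong = λ {x y} → preserve {ℓ} {x} {y} ; fE-cong = λ {x y} → preserve {suc ℓ} {x} {y}
  ; fV-inj = λ {x y} → reflect {ℓ} {x} {y} ; fE-inj = λ {x y} → reflect {suc ℓ} {x} {y}
  ; inc = λ w → inj₁ (LinkEq-refl (prefix (f* w)) , LinkEq-refl (suffix (f* w))) }
  where
  f* : ∀ {n} → Walk G n → Walk H n
  f* = mapWalk {G} {H} f
  preserve : ∀ {n} {x y : Walk G n} → LinkEq G n x y → LinkEq H n (f* x) (f* y)
  preserve {n} {x} {y} = LinkEq-map {G} {H} {n} {x} {y} {f* x} {f* y} (λ _ _ → cong (fV f)) (λ _ _ → cong (fE f))
  reflect : ∀ {n} {x y : Walk G n} → LinkEq H n (f* x) (f* y) → LinkEq G n x y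
  reflect {n} {x} {y} = LinkEq-map {H} {G} {n} {f* x} {f* y} {x} {y} (λ _ _ → fV-inj f) (λ _ _ → fE-inj f)

inverseIso : {G H : Graph} → Iso (toS G) (toS H) → Iso (toS H) (toS G)
inverseIso {G} {H} (f , onV , onE) = g , (λ x → fV f x , retractV x) , (λ e → fE f e , retractE e)
  where
  gV : V H → V G
  gV y = proj₁ (onV y)
  gE : E H → E G
  gE d = proj₁ (onE d)
  retractV : ∀ x → gV (fV f x) ≡ x
  retractV x = fV-inj f (proj₂ (onV (fV f x)))
  retractE : ∀ e → gE (fE f e) ≡ e
  retractE e = fE-inj f (proj₂ (onE (fE f e)))
  back : ∀ {x y} → y ≡ fV f x → x ≡ gV y
  back {x} p = trans (sym (retractV x)) (cong gV (sym p))
  gE-inc : ∀ d → UEq (toS G) (ends G (gE d)) (gV (proj₁ (ends H d)) , gV (proj₂ (ends H d)))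
  gE-inc d with subst (λ d' → UEq (toS H) (ends H d') _) (proj₂ (onE d)) (inc f (gE d))
  ... | inj₁ (p , q) = inj₁ (back p , back q)
  ... | inj₂ (p , q) = inj₂ (back q , back p)
  g : Embedding (toS H) (toS G)
  g = record
    { fV = gV ; fE = gE ; fV-cong = cong gV ; fE-cong = cong gE
    ; fV-inj = λ {y} {y'} p → trans (sym (proj₂ (onV y))) (trans (cong (fV f) p) (proj₂ (onV y')))
    ; fE-inj = λ {d} {d'} p → trans (sym (proj₂ (onE d))) (trans (cong (fE f) p) (proj₂ (onE d')))
    ; inc = gE-inc }

-- An isomorphism of graphs induces an isomorphism of their ℓ-link graphs:
-- every link of H is the image of its preimage under the inverse.
linkIso : {G H : Graph} (ℓ : ℕ) → Iso (toS G) (toS H) → Iso (Link ℓ G) (Link ℓ H)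
linkIso {G} {H} ℓ φ@(f , onV , onE) = linkEmbedding ℓ f , preimage , preimage
  where
  g = proj₁ (inverseIso {G} {H} φ)
  preimage : ∀ {n} (w : Walk H n) → ∃ λ w' → LinkEq H n (mapWalk {G} {H} f w') w
  preimage w = mapWalk {H} {G} g w , inj₁ ((λ i → proj₂ (onV (vs w i))) , (λ i → proj₂ (onE (es w i))))

module _ {Y H : Graph} (f : Embedding (toS Y) (toS H)) {n : ℕ} where

  missed-vertex : (w : Walk H n) (i : Fin (suc n)) → (∀ y → fV f y ≢ vs w i) →
    ∀ w' → ¬ LinkEq H n (mapWalk {Y} {H} f w') w
  missed-vertex w i miss w' same =
    let (k , eq) = LinkEq-vertex {H} {n} {mapWalk {Y} {H} f w'} {w} same i in miss (vs w' k) eq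

  missed-edge : (w : Walk H n) (i : Fin n) → (∀ e → fE f e ≢ es w i) →
    ∀ w' → ¬ LinkEq H n (mapWalk {Y} {H} f w') w
  missed-edge w i miss w' same =
    let (k , eq) = LinkEq-edge {H} {n} {mapWalk {Y} {H} f w'} {w} same i in miss (es w' k) eq

induced-∘-iso : {G H K : Graph} → InducedEmbedding (toS H) (toS K) → Iso (toS G) (toS H) →
  InducedEmbedding (toS G) (toS K)
induced-∘-iso {K = K} (g , g-induced) (φ , φ-onV , φ-onE) =
  compose (plain-setoidGraph K) g φ , λ d a b d-ab →
    let (e' , ge'≡d) = g-induced d (fV φ a) (fV φ b) d-ab ; (e , φe≡e') = φ-onE e' in
    e , trans (cong (fE g) φe≡e') ge'≡d

FiniteS-transfer : {A B : Set} {_≈A_ : A → A → Set} {_≈B_ : B → B → Set} →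
  IsEquivalence _≈B_ → (f : A → B) →
  (∀ {x y} → x ≈A y → f x ≈B f y) → (∀ {x y} → f x ≈B f y → x ≈A y) →
  (∀ y → ∃ λ x → f x ≈B y) → FiniteS A _≈A_ → FiniteS B _≈B_
FiniteS-transfer eqB f f-cong f-inj f-onto (n , enum , enum-inj , enum-onto) =
  n , (λ i → f (enum i)) , (λ i j p → enum-inj i j (f-inj p)) ,
  (λ y → let (x , p) = f-onto y ; (i , q) = enum-onto x in i , IsEquivalence.trans eqB (f-cong q) p)

LFinite-transfer : {ℓ : ℕ} {X Y : Graph} → Iso (Link ℓ X) (Link ℓ Y) → LFinite ℓ X → LFinite ℓ Y
LFinite-transfer (f , onV , onE) (finV , finE) =
  FiniteS-transfer LinkEq-isEquivalence (fV f) (fV-cong f) (fV-inj f) onV finV ,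
  FiniteS-transfer LinkEq-isEquivalence (fE f) (fE-cong f) (fE-inj f) onE finE

module Enumeration {A : Set} (_≈_ : A → A → Set) (fin : FiniteS A _≈_) where

  size : ℕ
  size = proj₁ fin

  enum : Fin size → A
  enum = proj₁ (proj₂ fin)

  enum-injective : ∀ i j → enum i ≈ enum j → i ≡ j
  enum-injective = proj₁ (proj₂ (proj₂ fin))

  index : A → Fin size
  index x = proj₁ (proj₂ (proj₂ (proj₂ fin)) x)

  enum-index : ∀ x → enum (index x) ≈ x
  enum-index x = proj₂ (proj₂ (proj₂ (proj₂ fin)) x)

  index-injective : IsEquivalence _≈_ → ∀ {x y} → index x ≡ index y → x ≈ y
  index-injective isEq {x} {y} p =
    ≈.trans (≈.sym (enum-index x)) (subst (λ k → enum k ≈ y) (sym p) (enum-index y))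
    where module ≈ = IsEquivalence isEq

indexed-injective : {A B : Set} {_≈A_ : A → A → Set} {_≈B_ : B → B → Set} →
  IsEquivalence _≈B_ → (finA : FiniteS A _≈A_) (finB : FiniteS B _≈B_) →
  (f : A → B) → (∀ {x y} → f x ≈B f y → x ≈A y) →
  let module A = Enumeration _≈A_ finA ; module B = Enumeration _≈B_ finB in
  ∀ {i j} → B.index (f (A.enum i)) ≡ B.index (f (A.enum j)) → i ≡ j
indexed-injective {_≈A_ = _≈A_} {_≈B_} eqB finA finB f f-inj p =
  Enumeration.enum-injective _≈A_ finA _ _ (f-inj (Enumeration.index-injective _≈B_ finB eqB p))

module _ (em : ExcludedMiddle 0ℓ) where

  -- Pigeonhole, classically: an injection Fin n → Fin m with m ≤ n is
  -- surjective, for a missed value would give an injection into Fin (m - 1).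
  injection-surjective : {n m : ℕ} (F : Fin n → Fin m) → (∀ {i j} → F i ≡ F j → i ≡ j) →
    m ≤ n → ∀ k → ∃ λ i → F i ≡ k
  injection-surjective {n} {suc m} F F-inj m≤n k with em {∃ λ i → F i ≡ k}
  ... | yes hit = hit
  ... | no miss = ⊥-elim (≤⇒≯ (injective⇒≤ {f = squeeze} squeeze-inj) m≤n)
    where
    k≢F : ∀ i → k ≢ F i
    k≢F i eq = miss (i , sym eq)
    squeeze : Fin n → Fin m
    squeeze i = punchOut (k≢F i)
    squeeze-inj : ∀ {i j} → squeeze i ≡ squeeze j → i ≡ j
    squeeze-inj {i} {j} eq = F-inj (punchOut-injective (k≢F i) (k≢F j) eq)

  -- Between finite setoids, if f : A → B and g : B → A are both injective
  -- then f is surjective: read through the enumerations, f and g become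
  -- injections Fin n → Fin m and Fin m → Fin n, so m ≤ n and pigeonhole applies.
  mutual-injections-surjective : {A B : Set} {_≈A_ : A → A → Set} {_≈B_ : B → B → Set} →
    IsEquivalence _≈A_ → IsEquivalence _≈B_ → FiniteS A _≈A_ → FiniteS B _≈B_ →
    (f : A → B) → (∀ {x y} → f x ≈B f y → x ≈A y) →
    (g : B → A) → (∀ {x y} → g x ≈A g y → x ≈B y) →
    ∀ y → ∃ λ x → f x ≈B y
  mutual-injections-surjective {_≈A_ = _≈A_} {_≈B_} eqA eqB finA finB f f-inj g g-inj y =
    A.enum i , B.index-injective eqB Fi≡y
    where
    module A = Enumeration _≈A_ finA
    module B = Enumeration _≈B_ finB
    hit = injection-surjective (λ i → B.index (f (A.enum i))) (indexed-injective eqB finA finB f f-inj)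
            (injective⇒≤ (indexed-injective eqA finB finA g g-inj)) (B.index y)
    i = proj₁ hit
    Fi≡y = proj₂ hit

  linkEmbedding-onto : {ℓ : ℕ} {A B : Graph} → LFinite ℓ A → LFinite ℓ B →
    (f : Embedding (Link ℓ A) (Link ℓ B)) → Embedding (Link ℓ B) (Link ℓ A) →
    (∀ y → ∃ λ x → LinkEq B ℓ (fV f x) y) × (∀ y → ∃ λ x → LinkEq B (suc ℓ) (fE f x) y)
  linkEmbedding-onto (finVA , finEA) (finVB , finEB) f g =
    mutual-injections-surjective LinkEq-isEquivalence LinkEq-isEquivalence finVA finVB
      (fV f) (fV-inj f) (fV g) (fV-inj g) ,
    mutual-injections-surjective LinkEq-isEquivalence LinkEq-isEquivalence finEA finEB
      (fE f) (fE-inj f) (fE g) (fE-inj g)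

longer-side : ∀ {p n} → p ≤ n → n ≤ p + p ⊎ n ≤ (n ∸ p) + (n ∸ p)
longer-side {p} {n} p≤n with p ≤? n ∸ p
... | yes p≤n∸p = inj₂ (subst (_≤ (n ∸ p) + (n ∸ p)) (m+[n∸m]≡n p≤n) (+-monoˡ-≤ (n ∸ p) p≤n∸p))
... | no p≰n∸p = inj₁ (subst (_≤ p + p) (m+[n∸m]≡n p≤n) (+-monoʳ-≤ p (<⇒≤ (≰⇒> p≰n∸p))))

split-length : ∀ {ℓ A B} → ℓ ≤ A + A → ℓ ≤ B + B → ∃ λ a → ∃ λ b → a ≤ A × b ≤ B × a + b ≡ ℓ
split-length {ℓ} {A} {B} ℓ≤A+A ℓ≤B+B with ℓ ≤? A
... | yes ℓ≤A = ℓ , 0 , ℓ≤A , z≤n , +-identityʳ ℓ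
... | no ℓ≰A = A , ℓ ∸ A , ≤-refl , m≤n+o⇒m∸n≤o ℓ A ℓ≤A+B , m+[n∸m]≡n (<⇒≤ (≰⇒> ℓ≰A))
  where
  ℓ≤A+B : ℓ ≤ A + B
  ℓ≤A+B with ≤-total A B
  ... | inj₁ A≤B = ≤-trans ℓ≤A+A (+-monoʳ-≤ A A≤B)
  ... | inj₂ B≤A = ≤-trans ℓ≤B+B (+-monoˡ-≤ B B≤A)

glue : {A : Set} → ℕ → (ℕ → A) → (ℕ → A) → ℕ → A
glue a f g k with k <? a
... | yes _ = f k
... | no _ = g (k ∸ a)

module Glue {A : Set} (a : ℕ) (f g : ℕ → A) where

  glue-< : ∀ {k} → k < a → glue a f g k ≡ f k
  glue-< {k} k<a with k <? a
  ... | yes _ = refl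
  ... | no k≮a = ⊥-elim (k≮a k<a)

  glue-≥ : ∀ {k} → a ≤ k → glue a f g k ≡ g (k ∸ a)
  glue-≥ {k} a≤k with k <? a
  ... | yes k<a = ⊥-elim (<⇒≱ k<a a≤k)
  ... | no _ = refl

  glue-suc-≥ : ∀ {k} → a ≤ k → glue a f g (suc k) ≡ g (suc (k ∸ a))
  glue-suc-≥ a≤k = trans (glue-≥ (m≤n⇒m≤1+n a≤k)) (cong g (+-∸-assoc 1 a≤k))

atℕ : {A : Set} {m : ℕ} → A → (Fin m → A) → ℕ → A
atℕ {m = m} x f k with k <? m
... | yes k<m = f (fromℕ< k<m)
... | no _ = x

atℕ-toℕ : {A : Set} {m : ℕ} (x : A) (f : Fin m → A) {k : ℕ} (i : Fin m) →
  toℕ i ≡ k → atℕ x f k ≡ f i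
atℕ-toℕ {m = m} x f {k} i refl with toℕ i <? m
... | yes lt = cong f (fromℕ<-toℕ i lt)
... | no ¬lt = ⊥-elim (¬lt (toℕ<n i))

module _ {G : Graph} where

  -- Non-backtracking walks of length n given by ℕ-indexed sequences (only
  -- vertex k for k ≤ n and edge k for k < n matter).  Unlike Fin-indexed
  -- walks they are easy to cut, reverse and concatenate.
  record Walkℕ (n : ℕ) : Set where
    field
      vertex      : ℕ → V G
      edge        : ℕ → E G
      step        : ∀ k → k < n → Joins G (edge k) (vertex k) (vertex (suc k))
      noBacktrack : ∀ k → suc k < n → edge k ≢ edge (suc k)
  open Walkℕ public

  Avoids : {n : ℕ} → E G → Walkℕ n → Set
  Avoids {n} d W = ∀ k → k < n → edge W k ≢ d

  take : {m n : ℕ} → m ≤ n → Walkℕ n → Walkℕ m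
  take m≤n W = record
    { vertex = vertex W ; edge = edge W
    ; step = λ k k<m → step W k (<-≤-trans k<m m≤n)
    ; noBacktrack = λ k k<m → noBacktrack W k (<-≤-trans k<m m≤n) }

  take-avoids : ∀ {m n d} {W : Walkℕ n} (m≤n : m ≤ n) → Avoids d W → Avoids d (take m≤n W)
  take-avoids m≤n avoid k k<m = avoid k (<-≤-trans k<m m≤n)

  drop : {n : ℕ} (p : ℕ) → p ≤ n → Walkℕ n → Walkℕ (n ∸ p)
  drop {n} p p≤n W = record
    { vertex = λ k → vertex W (k + p) ; edge = λ k → edge W (k + p)
    ; step = λ k k<n∸p → step W (k + p) (shift k<n∸p)
    ; noBacktrack = λ k k<n∸p → noBacktrack W (k + p) (shift k<n∸p) }
    where
    shift : ∀ {k} → k < n ∸ p → k + p < n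
    shift {k} = m≤o∸n⇒m+n≤o (suc k) p≤n

  drop-avoids : ∀ {n d} {W : Walkℕ n} (p : ℕ) (p≤n : p ≤ n) → Avoids d W → Avoids d (drop p p≤n W)
  drop-avoids p p≤n avoid k k<n∸p = avoid (k + p) (m≤o∸n⇒m+n≤o (suc k) p≤n k<n∸p)

  -- position n ∸ suc k is the mirror image of edge k; its successor is n ∸ k
  private
    mirror : ∀ {n k} → k < n → n ∸ suc k < n
    mirror {n} {k} k<n = ∸-monoʳ-< {n} {suc k} {0} z<s k<n

    mirror-suc : ∀ {n k} → k < n → suc (n ∸ suc k) ≡ n ∸ k
    mirror-suc k<n = sym (+-∸-assoc 1 k<n)

  reverse : {n : ℕ} → Walkℕ n → Walkℕ n
  reverse {n} W = record
    { vertex = λ k → vertex W (n ∸ k)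
    ; edge = λ k → edge W (n ∸ suc k)
    ; step = λ k k<n → Joins-sym {G}
        (subst (λ j → Joins G (edge W (n ∸ suc k)) (vertex W (n ∸ suc k)) (vertex W j)) (mirror-suc k<n)
               (step W (n ∸ suc k) (mirror k<n)))
    ; noBacktrack = λ k sk<n eq → noBacktrack W (n ∸ suc (suc k))
                      (subst (_< n) (sym (mirror-suc sk<n)) (mirror (<-trans (n<1+n k) sk<n)))
                      (sym (trans (cong (edge W) (mirror-suc sk<n)) eq)) }

  reverse-avoids : ∀ {n d} {W : Walkℕ n} → Avoids d W → Avoids d (reverse W)
  reverse-avoids avoid k k<n = avoid _ (mirror k<n)

  concat : {a b : ℕ} (W₁ : Walkℕ a) (W₂ : Walkℕ b) → vertex W₁ a ≡ vertex W₂ 0 →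
    (∀ k → suc k ≡ a → 0 < b → edge W₁ k ≢ edge W₂ 0) → Walkℕ (a + b)
  concat {a} {b} W₁ W₂ meet junction = record
    { vertex = glue a (vertex W₁) (vertex W₂)
    ; edge = glue a (edge W₁) (edge W₂)
    ; step = step′
    ; noBacktrack = noBacktrack′ }
    where
    module GV = Glue a (vertex W₁) (vertex W₂)
    module GE = Glue a (edge W₁) (edge W₂)

    vertex-≤ : ∀ {k} → k ≤ a → glue a (vertex W₁) (vertex W₂) k ≡ vertex W₁ k
    vertex-≤ k≤a with m≤n⇒m<n∨m≡n k≤a
    ... | inj₁ k<a = GV.glue-< k<a
    ... | inj₂ refl = trans (GV.glue-≥ ≤-refl) (trans (cong (vertex W₂) (n∸n≡0 a)) (sym meet))

    in-second : ∀ {k} → a ≤ k → k < a + b → k ∸ a < b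
    in-second {k} a≤k k<a+b = subst (k ∸ a <_) (m+n∸m≡n a b) (∸-monoˡ-< k<a+b a≤k)

    step′ : ∀ k → k < a + b → Joins G (glue a (edge W₁) (edge W₂) k)
              (glue a (vertex W₁) (vertex W₂) k) (glue a (vertex W₁) (vertex W₂) (suc k))
    step′ k k<a+b with <-≤-connex k a
    ... | inj₁ k<a = Joins-cong {G} (sym (GE.glue-< k<a)) (sym (GV.glue-< k<a)) (sym (vertex-≤ k<a))
                       (step W₁ k k<a)
    ... | inj₂ a≤k = Joins-cong {G} (sym (GE.glue-≥ a≤k)) (sym (GV.glue-≥ a≤k)) (sym (GV.glue-suc-≥ a≤k))
                       (step W₂ (k ∸ a) (in-second a≤k k<a+b))

    noBacktrack′ : ∀ k → suc k < a + b →
      glue a (edge W₁) (edge W₂) k ≢ glue a (edge W₁) (edge W₂) (suc k)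
    noBacktrack′ k sk<a+b with <-cmp (suc k) a
    ... | tri< sk<a _ _ = λ eq →
      noBacktrack W₁ k sk<a (trans (sym (GE.glue-< (<-trans (n<1+n k) sk<a))) (trans eq (GE.glue-< sk<a)))
    ... | tri≈ _ refl _ = λ eq →
      junction k refl 0<b
        (trans (sym (GE.glue-< (n<1+n k))) (trans eq (trans (GE.glue-≥ ≤-refl) (cong (edge W₂) (n∸n≡0 a)))))
      where 0<b = +-cancelˡ-< a 0 b (subst (_< a + b) (sym (+-identityʳ a)) sk<a+b)
    ... | tri> _ _ a<sk = λ eq →
      noBacktrack W₂ (k ∸ a) (subst (_< b) (+-∸-assoc 1 a≤k) (in-second (<⇒≤ a<sk) sk<a+b))
        (trans (sym (GE.glue-≥ a≤k)) (trans eq (GE.glue-suc-≥ a≤k)))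
      where a≤k = m<1+n⇒m≤n a<sk

  edgeWalk : {d : E G} {u v : V G} → Joins G d u v → Walkℕ 1
  edgeWalk {d} {u} {v} J = record
    { vertex = λ { zero → u ; (suc _) → v }
    ; edge = λ _ → d
    ; step = λ { zero _ → J ; (suc _) (s≤s ()) }
    ; noBacktrack = λ { _ (s≤s ()) } }

  module _ {a b : ℕ} {d : E G} {u v : V G} (J : Joins G d u v)
           (L : Walkℕ a) (R : Walkℕ b) (L-end : vertex L a ≡ u) (R-start : vertex R 0 ≡ v)
           (L-avoids : Avoids d L) (R-avoids : Avoids d R) where

    private
      dR : Walkℕ (suc b)
      dR = concat (edgeWalk J) R (sym R-start) (λ _ _ 0<b eq → R-avoids 0 0<b (sym eq))

    splice : Walkℕ (a + suc b)
    splice = concat L dR (trans L-end (sym (Glue.glue-< 1 (vertex (edgeWalk J)) (vertex R) z<s)))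
               (λ k sk≡a _ eq → L-avoids k (subst (k <_) sk≡a (n<1+n k))
                                  (trans eq (Glue.glue-< 1 (edge (edgeWalk J)) (edge R) z<s)))

    splice-edge : edge splice a ≡ d
    splice-edge = trans (Glue.glue-≥ a (edge L) (edge dR) ≤-refl)
                   (trans (cong (edge dR) (n∸n≡0 a)) (Glue.glue-< 1 (edge (edgeWalk J)) (edge R) z<s))

  -- From position p of a walk W avoiding d starts a walk avoiding d of at
  -- least half the length of W: the part after p, or the part before p reversed.
  halfWalkFrom : {n p : ℕ} {d : E G} (W : Walkℕ n) → Avoids d W → p ≤ n →
    Σ ℕ λ A → Σ (Walkℕ A) λ R → vertex R 0 ≡ vertex W p × Avoids d R × n ≤ A + A
  halfWalkFrom {n} {p} W avoid p≤n with longer-side p≤n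
  ... | inj₁ n≤p+p =
    p , reverse (take p≤n W) , refl , reverse-avoids {W = take p≤n W} (take-avoids {W = W} p≤n avoid) , n≤p+p
  ... | inj₂ long = n ∸ p , drop p p≤n W , refl , drop-avoids {W = W} p p≤n avoid , long

  cast : {n m : ℕ} → n ≡ m → Walkℕ n → Walkℕ m
  cast n≡m W = record
    { vertex = vertex W ; edge = edge W
    ; step = λ k k<m → step W k (subst (k <_) (sym n≡m) k<m)
    ; noBacktrack = λ k k<m → noBacktrack W k (subst (suc k <_) (sym n≡m) k<m) }

  toWalk : {n : ℕ} → Walkℕ n → Walk G n
  toWalk {n} W = record
    { vs = λ i → vertex W (toℕ i)
    ; es = λ i → edge W (toℕ i)
    ; joins = λ i → subst (λ k → Joins G (edge W (toℕ i)) (vertex W k) (vertex W (suc (toℕ i))))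
                      (sym (toℕ-inject₁ i)) (step W (toℕ i) (toℕ<n i))
    ; nobt = λ i j j≡1+i eq →
        noBacktrack W (toℕ i) (subst (_< n) j≡1+i (toℕ<n j)) (trans eq (cong (edge W) j≡1+i)) }

  -- (d is the default edge outside the range)
  fromWalk : {n : ℕ} → E G → Walk G n → Walkℕ n
  fromWalk {n} d w = record
    { vertex = atℕ (vs w zero) (vs w)
    ; edge = atℕ d (es w)
    ; step = λ k k<n → let i = fromℕ< k<n ; i≡k = toℕ-fromℕ< k<n in
        Joins-cong {G} (sym (atℕ-toℕ _ _ i i≡k)) (sym (atℕ-toℕ _ _ (inject₁ i) (trans (toℕ-inject₁ i) i≡k)))
                   (sym (atℕ-toℕ _ _ (suc i) (cong suc i≡k))) (joins w i)
    ; noBacktrack = λ k sk<n eq → let k<n = <-trans (n<1+n k) sk<n in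
        nobt w (fromℕ< k<n) (fromℕ< sk<n) (trans (toℕ-fromℕ< sk<n) (cong suc (sym (toℕ-fromℕ< k<n))))
          (trans (sym (atℕ-toℕ _ _ _ (toℕ-fromℕ< k<n))) (trans eq (atℕ-toℕ _ _ _ (toℕ-fromℕ< sk<n)))) }

  fromWalk-avoids : {n : ℕ} {d : E G} (w : Walk G n) → ¬ (∃ λ i → es w i ≡ d) → Avoids d (fromWalk d w)
  fromWalk-avoids w off k k<n eq = off (fromℕ< k<n , trans (sym (atℕ-toℕ _ _ _ (toℕ-fromℕ< k<n))) eq)

OnLink : (ℓ : ℕ) (G : Graph) → V G → Set
OnLink ℓ G v = Σ (Walk G ℓ) λ w → ∃ λ i → vs w i ≡ v

EdgeOnLink : (ℓ : ℕ) (G : Graph) → E G → Set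
EdgeOnLink ℓ G e =
  (Σ (Walk G ℓ) λ w → ∃ λ i → es w i ≡ e) ⊎ (Σ (Walk G (suc ℓ)) λ w → ∃ λ i → es w i ≡ e)

-- An edge d from u to v, where u and v lie on ℓ-walks avoiding d, lies on
-- an (ℓ+1)-walk: half-walks from u and from v, of lengths a + b = ℓ,
-- joined along d.
edge-extends-walks : {G : Graph} {ℓ : ℕ} {d : E G} {u v : V G} → Joins G d u v →
  (W W' : Walkℕ ℓ) → Avoids d W → Avoids d W' → ∀ {p q} → p ≤ ℓ → q ≤ ℓ →
  vertex W p ≡ u → vertex W' q ≡ v → Σ (Walk G (suc ℓ)) λ w → ∃ λ i → es w i ≡ d
edge-extends-walks {ℓ = ℓ} J W W' W-avoids W'-avoids p≤ℓ q≤ℓ W-u W'-v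
  with halfWalkFrom W W-avoids p≤ℓ | halfWalkFrom W' W'-avoids q≤ℓ
... | A , RU , RU-start , RU-avoids , ℓ≤A+A | B , RV , RV-start , RV-avoids , ℓ≤B+B
  with split-length ℓ≤A+A ℓ≤B+B
... | a , b , a≤A , b≤B , a+b≡ℓ =
  toWalk (cast (trans (+-suc a b) (cong suc a+b≡ℓ)) joined) , fromℕ< a<1+ℓ ,
  trans (cong (edge joined) (toℕ-fromℕ< a<1+ℓ)) (splice-edge J L R L-end R-start L-avoids R-avoids)
  where
  L = reverse (take a≤A RU)
  R = take b≤B RV
  L-end = trans (cong (vertex RU) (n∸n≡0 a)) (trans RU-start W-u)
  R-start = trans RV-start W'-v
  L-avoids = reverse-avoids {W = take a≤A RU} (take-avoids {W = RU} a≤A RU-avoids)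
  R-avoids = take-avoids {W = RV} b≤B RV-avoids
  joined = splice J L R L-end R-start L-avoids R-avoids
  a<1+ℓ : a < suc ℓ
  a<1+ℓ = s≤s (subst (a ≤_) a+b≡ℓ (m≤m+n a b))

-- An edge between two vertices that lie on ℓ-links lies on an ℓ-link or
-- an (ℓ+1)-link (classically: either some link through an endpoint
-- already uses it, or the walks avoid it and the previous lemma applies).
edge-between-linked : ExcludedMiddle 0ℓ → {ℓ : ℕ} {G : Graph} {d : E G} {u v : V G} →
  Joins G d u v → OnLink ℓ G u → OnLink ℓ G v → EdgeOnLink ℓ G d
edge-between-linked em {d = d} J (w , i , w-u) (w' , j , w'-v)
  with em {∃ λ k → es w k ≡ d} | em {∃ λ k → es w' k ≡ d}
... | yes on-w | _ = inj₁ (w , on-w)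
... | no _ | yes on-w' = inj₁ (w' , on-w')
... | no off-w | no off-w' = inj₂ (edge-extends-walks J (fromWalk d w) (fromWalk d w')
        (fromWalk-avoids w off-w) (fromWalk-avoids w' off-w') (toℕ≤pred[n] i) (toℕ≤pred[n] j)
        (trans (atℕ-toℕ _ _ i refl) w-u) (trans (atℕ-toℕ _ _ j refl) w'-v))

Σ-≡-irrelevant : {A : Set} {P : A → Set} → (∀ {a} → Irrelevant (P a)) →
  {x y : Σ A P} → proj₁ x ≡ proj₁ y → x ≡ y
Σ-≡-irrelevant irr {x , p} {.x , q} refl = cong (x ,_) (irr p q)

module Core (em : ExcludedMiddle 0ℓ) (ℓ : ℕ) where

  -- v lies on an ℓ-link, as a proof-irrelevant proposition (decided classically)
  Linked : (G : Graph) → V G → Set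
  Linked G v = T (isYes (em {OnLink ℓ G v}))

  linked-intro : {G : Graph} {v : V G} → OnLink ℓ G v → Linked G v
  linked-intro = fromWitness

  linked-elim : {G : Graph} {v : V G} → Linked G v → OnLink ℓ G v
  linked-elim {G} {v} = toWitness {a? = em {OnLink ℓ G v}}

  BothLinked : (G : Graph) → E G → Set
  BothLinked G e = Linked G (proj₁ (ends G e)) × Linked G (proj₂ (ends G e))

  core : Graph → Graph
  core G = record
    { V = Σ (V G) (Linked G)
    ; E = Σ (E G) (BothLinked G)
    ; ends = λ (e , a , b) → (proj₁ (ends G e) , a) , (proj₂ (ends G e) , b)
    ; noLoop = λ (e , _) eq → noLoop G e (cong proj₁ eq) }

  module _ {G : Graph} where

    coreV-≡ : {x y : V (core G)} → proj₁ x ≡ proj₁ y → x ≡ y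
    coreV-≡ = Σ-≡-irrelevant T-irrelevant

    coreE-≡ : {x y : E (core G)} → proj₁ x ≡ proj₁ y → x ≡ y
    coreE-≡ = Σ-≡-irrelevant λ (p , q) (p' , q') → cong₂ _,_ (T-irrelevant p p') (T-irrelevant q q')

    coreInclusion : Embedding (toS (core G)) (toS G)
    coreInclusion = record
      { fV = proj₁ ; fE = proj₁ ; fV-cong = cong proj₁ ; fE-cong = cong proj₁
      ; fV-inj = coreV-≡ ; fE-inj = coreE-≡ ; inc = λ _ → inj₁ (refl , refl) }

    core-induced : InducedEmbedding (toS (core G)) (toS G)
    core-induced = coreInclusion ,
      λ d a b d-ab → (d , Joins-ends {G} {Linked G} (UEq→Joins {G} d-ab) (proj₂ a) (proj₂ b)) , refl

    lift-Joins : {e : E G} {a b : V G} {e-linked : BothLinked G e} {a-linked : Linked G a}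
      {b-linked : Linked G b} → Joins G e a b → Joins (core G) (e , e-linked) (a , a-linked) (b , b-linked)
    lift-Joins (inj₁ eq) = inj₁ (cong₂ _,_ (coreV-≡ (cong proj₁ eq)) (coreV-≡ (cong proj₂ eq)))
    lift-Joins (inj₂ eq) = inj₂ (cong₂ _,_ (coreV-≡ (cong proj₁ eq)) (coreV-≡ (cong proj₂ eq)))

    liftWalk : {n : ℕ} (w : Walk G n) → (∀ i → Linked G (vs w i)) → Walk (core G) n
    liftWalk w linked = record
      { vs = λ i → vs w i , linked i
      ; es = λ i → es w i , Joins-ends {G} {Linked G} (joins w i) (linked (inject₁ i)) (linked (suc i))
      ; joins = λ i → lift-Joins (joins w i)
      ; nobt = λ i j j≡1+i eq → nobt w i j j≡1+i (cong proj₁ eq) }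

    linked-ℓ : (w : Walk G ℓ) (i : Fin (suc ℓ)) → Linked G (vs w i)
    linked-ℓ w i = linked-intro (w , i , refl)

    linked-suc : (w : Walk G (suc ℓ)) (i : Fin (suc (suc ℓ))) → Linked G (vs w i)
    linked-suc w zero = linked-intro (prefix w , zero , refl)
    linked-suc w (suc i) = linked-intro (suffix w , i , refl)

    same-underlying : {n : ℕ} (x y : Walk (core G) n) →
      (∀ i → proj₁ (vs x i) ≡ proj₁ (vs y i)) → (∀ i → proj₁ (es x i) ≡ proj₁ (es y i)) →
      LinkEq (core G) n x y
    same-underlying x y p q = inj₁ ((λ i → coreV-≡ (p i)) , (λ i → coreE-≡ (q i)))

    -- All ℓ-links and (ℓ+1)-links of G live in the core, so G and its core
    -- have the same ℓ-link graph.
    coreLinkIso : Iso (Link ℓ G) (Link ℓ (core G))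
    coreLinkIso = lifting ,
      (λ x → underlying x , same-underlying (lift (underlying x)) x (λ _ → refl) (λ _ → refl)) ,
      (λ x → underlying x , same-underlying (lift₊ (underlying x)) x (λ _ → refl) (λ _ → refl))
      where
      underlying : ∀ {n} → Walk (core G) n → Walk G n
      underlying = mapWalk {core G} {G} coreInclusion
      lift : Walk G ℓ → Walk (core G) ℓ
      lift w = liftWalk w (linked-ℓ w)
      lift₊ : Walk G (suc ℓ) → Walk (core G) (suc ℓ)
      lift₊ w = liftWalk w (linked-suc w)
      lifting : Embedding (Link ℓ G) (Link ℓ (core G))
      lifting = record
        { fV = lift ; fE = lift₊
        ; fV-cong = λ {x y} → LinkEq-map {G} {core G} {ℓ} {x} {y} {lift x} {lift y}
                                (λ _ _ → coreV-≡) (λ _ _ → coreE-≡)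
        ; fE-cong = λ {x y} → LinkEq-map {G} {core G} {suc ℓ} {x} {y} {lift₊ x} {lift₊ y}
                                (λ _ _ → coreV-≡) (λ _ _ → coreE-≡)
        ; fV-inj = λ {x y} → LinkEq-map {core G} {G} {ℓ} {lift x} {lift y} {x} {y}
                               (λ _ _ → cong proj₁) (λ _ _ → cong proj₁)
        ; fE-inj = λ {x y} → LinkEq-map {core G} {G} {suc ℓ} {lift₊ x} {lift₊ y} {x} {y}
                               (λ _ _ → cong proj₁) (λ _ _ → cong proj₁)
        ; inc = λ w → inj₁ ( same-underlying (prefix (lift₊ w)) (lift (prefix w)) (λ _ → refl) (λ _ → refl)
                           , same-underlying (suffix (lift₊ w)) (lift (suffix w)) (λ _ → refl) (λ _ → refl)) }

  module _ {Z X : Graph} (f : Embedding (toS Z) (toS X))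
    (onto : ∀ (w : Walk X ℓ) → ∃ λ w' → LinkEq X ℓ (mapWalk {Z} {X} f w') w)
    (onto₊ : ∀ (w : Walk X (suc ℓ)) → ∃ λ w' → LinkEq X (suc ℓ) (mapWalk {Z} {X} f w') w) where

    private
      f* : ∀ {n} → Walk Z n → Walk X n
      f* = mapWalk {Z} {X} f

      push : ∀ {v} → Linked Z v → Linked X (fV f v)
      push p = let (w , i , eq) = linked-elim p in linked-intro (f* w , i , cong (fV f) eq)

      hV : V (core Z) → V (core X)
      hV (v , p) = fV f v , push p

      hE : E (core Z) → E (core X)
      hE (e , p , q) = fE f e , Joins-ends {X} {Linked X} (Joins-map {Z} {X} f (Joins-ends-self Z e)) (push p) (push q)

      h-inc : ∀ e → UEq (toS (core X)) (ends (core X) (hE e))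
                         (hV (proj₁ (ends (core Z) e)) , hV (proj₂ (ends (core Z) e)))
      h-inc (e , _) with inc f e
      ... | inj₁ (p , q) = inj₁ (coreV-≡ p , coreV-≡ q)
      ... | inj₂ (p , q) = inj₂ (coreV-≡ p , coreV-≡ q)

      edge-preimage : ∀ {n} → (∀ (w' : Walk Z n) i → Linked Z (vs w' i)) →
        (w : Walk X n) → (∃ λ w' → LinkEq X n (f* w') w) →
        ∀ i (x : E (core X)) → es w i ≡ proj₁ x → ∃ λ y → hE y ≡ x
      edge-preimage linked w (w' , same) i x eq =
        let (k , fk≡i) = LinkEq-edge {X} {_} {f* w'} {w} same i in
        (es w' k , Joins-ends {Z} {Linked Z} (joins w' k) (linked w' _) (linked w' _)) , coreE-≡ (trans fk≡i eq)

    coreIso : Iso (toS (core Z)) (toS (core X))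
    coreIso = embedding , onV , onE
      where
      embedding : Embedding (toS (core Z)) (toS (core X))
      embedding = record
        { fV = hV ; fE = hE ; fV-cong = cong hV ; fE-cong = cong hE
        ; fV-inj = λ eq → coreV-≡ (fV-inj f (cong proj₁ eq))
        ; fE-inj = λ eq → coreE-≡ (fE-inj f (cong proj₁ eq))
        ; inc = h-inc }
      onV : ∀ x → ∃ λ y → hV y ≡ x
      onV (x , p) =
        let (w , i , eq) = linked-elim p ; (w' , same) = onto w
            (k , fk≡i) = LinkEq-vertex {X} {ℓ} {f* w'} {w} same i in
        (vs w' k , linked-ℓ w' k) , coreV-≡ (trans fk≡i eq)
      onE : ∀ x → ∃ λ y → hE y ≡ x
      onE x@(d , p , q) with edge-between-linked em (Joins-ends-self X d) (linked-elim p) (linked-elim q)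
      ... | inj₁ (w , i , eq) = edge-preimage linked-ℓ w (onto w) i x eq
      ... | inj₂ (w , i , eq) = edge-preimage linked-suc w (onto₊ w) i x eq

  -- ℓ-equivalent ℓ-finite graphs have isomorphic cores: the common
  -- subgraph Z embeds into each with a finite link graph isomorphic to
  -- theirs, so each link embedding is onto and coreIso applies twice.
  equivalent-cores : {X Y : Graph} → LFinite ℓ X → LFinite ℓ Y → LEquiv ℓ X Y →
    Iso (toS (core X)) (toS (core Y))
  equivalent-cores {X} {Y} X-finite Y-finite (Z , a , b , X≅Z , Y≅Z) =
    composeIso (plain-setoidGraph (core Y)) (coreIso b (proj₁ b-onto) (proj₂ b-onto))
      (inverseIso {core Z} {core X} (coreIso a (proj₁ a-onto) (proj₂ a-onto)))
    where
    Z-finite = LFinite-transfer {ℓ} {X} {Z} X≅Z X-finite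
    a-onto = linkEmbedding-onto em Z-finite X-finite (linkEmbedding {Z} {X} ℓ a) (proj₁ X≅Z)
    b-onto = linkEmbedding-onto em Z-finite Y-finite (linkEmbedding {Z} {Y} ℓ b) (proj₁ Y≅Z)

  -- The core is ℓ-minimal: a proper subgraph of the core misses a core
  -- vertex or edge, hence misses a link of the core through it.
  core-minimal : (X : Graph) → LMinimal ℓ (core X)
  core-minimal X = inj₂ λ Y (f , missing) → linkEmbedding {Y} {core X} ℓ f , missed-link f missing
    where
    lift : Walk X ℓ → Walk (core X) ℓ
    lift w = liftWalk w (linked-ℓ w)
    lift₊ : Walk X (suc ℓ) → Walk (core X) (suc ℓ)
    lift₊ w = liftWalk w (linked-suc w)
    missed-link : {Y : Graph} (f : Embedding (toS Y) (toS (core X))) →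
      (∃ λ y → ∀ x → fV f x ≢ y) ⊎ (∃ λ d → ∀ e → fE f e ≢ d) →
      (∃ λ W → ∀ w → ¬ LinkEq (core X) ℓ (mapWalk {Y} {core X} f w) W) ⊎
      (∃ λ D → ∀ w → ¬ LinkEq (core X) (suc ℓ) (mapWalk {Y} {core X} f w) D)
    missed-link f (inj₁ ((v , p) , miss)) =
      let (w , i , eq) = linked-elim p in
      inj₁ (lift w , missed-vertex f (lift w) i λ y fy≡ → miss y (trans fy≡ (coreV-≡ eq)))
    missed-link f (inj₂ ((d , p , q) , miss))
      with edge-between-linked em (Joins-ends-self X d) (linked-elim p) (linked-elim q)
    ... | inj₁ (w , i , eq) =
      inj₁ (lift w , missed-edge f (lift w) i λ e fe≡ → miss e (trans fe≡ (coreE-≡ eq)))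
    ... | inj₂ (w , i , eq) =
      inj₂ (lift₊ w , missed-edge f (lift₊ w) i λ e fe≡ → miss e (trans fe≡ (coreE-≡ eq)))

  all-linked-core : (M : Graph) → (∀ v → Linked M v) → Iso (toS M) (toS (core M))
  all-linked-core M linked = embedding , (λ x → proj₁ x , coreV-≡ refl) , (λ x → proj₁ x , coreE-≡ refl)
    where
    embedding : Embedding (toS M) (toS (core M))
    embedding = record
      { fV = λ v → v , linked v ; fE = λ e → e , linked _ , linked _
      ; fV-cong = cong (λ v → v , linked v) ; fE-cong = cong (λ e → e , linked _ , linked _)
      ; fV-inj = cong proj₁ ; fE-inj = cong proj₁
      ; inc = λ e → inj₁ (coreV-≡ refl , coreV-≡ refl) }

  -- In an ℓ-finite ℓ-minimal graph every vertex is linked: otherwise the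
  -- core is a proper subgraph, so minimality makes its link graph a proper
  -- subgraph of the (isomorphic, finite) link graph of M — impossible.
  minimal-all-linked : (M : Graph) → LFinite ℓ M → LMinimal ℓ M → ∀ v → Linked M v
  minimal-all-linked M M-finite M-minimal v = by-cases (em {OnLink ℓ M v})
    where
    minimality : ∀ Y → ProperEmbedding (toS Y) (toS M) → ProperEmbedding (Link ℓ Y) (Link ℓ M)
    minimality = [ (λ null → ⊥-elim (null v)) , (λ minimal → minimal) ] M-minimal
    core-finite = LFinite-transfer {ℓ} {M} {core M} coreLinkIso M-finite
    not-proper : ¬ ProperEmbedding (Link ℓ (core M)) (Link ℓ M)
    not-proper (g , inj₁ (W , miss)) =
      let (w , same) = proj₁ (linkEmbedding-onto em core-finite M-finite g (proj₁ coreLinkIso)) W in miss w same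
    not-proper (g , inj₂ (D , miss)) =
      let (w , same) = proj₂ (linkEmbedding-onto em core-finite M-finite g (proj₁ coreLinkIso)) D in miss w same
    by-cases : Dec (OnLink ℓ M v) → Linked M v
    by-cases (yes on-link) = linked-intro on-link
    by-cases (no off-link) = ⊥-elim (not-proper (minimality (core M) (coreInclusion , inj₁ (v , missed))))
      where
      missed : ∀ x → proj₁ x ≢ v
      missed (x , p) refl = off-link (linked-elim p)

  -- ℓ-equivalence is transitive: X and W are both equivalent to the core of X.
  LEquiv-trans : {X Y W : Graph} → LFinite ℓ X → LFinite ℓ Y → LFinite ℓ W →
    LEquiv ℓ X Y → LEquiv ℓ Y W → LEquiv ℓ X W
  LEquiv-trans {X} {Y} {W} X-finite Y-finite W-finite X~Y Y~W =
    core X , coreInclusion , compose (plain-setoidGraph W) coreInclusion (proj₁ φ) , coreLinkIso ,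
    composeIso (link-setoidGraph ℓ (core X)) (linkIso ℓ (inverseIso {core X} {core W} φ)) coreLinkIso
    where
    φ : Iso (toS (core X)) (toS (core W))
    φ = composeIso (plain-setoidGraph (core W)) (equivalent-cores Y-finite W-finite Y~W)
          (equivalent-cores X-finite Y-finite X~Y)

LEquiv-refl : {ℓ : ℕ} (X : Graph) → LEquiv ℓ X X
LEquiv-refl {ℓ} X = X , idEmbedding (plain-setoidGraph X) , idEmbedding (plain-setoidGraph X) ,
  idIso (link-setoidGraph ℓ X) , idIso (link-setoidGraph ℓ X)

LEquiv-sym : {ℓ : ℕ} {X Y : Graph} → LEquiv ℓ X Y → LEquiv ℓ Y X
LEquiv-sym (Z , a , b , X≅Z , Y≅Z) = Z , b , a , Y≅Z , X≅Z

lemma1p2 : ExcludedMiddle 0ℓ → (ℓ : ℕ) →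
    ((X : Graph) → LFinite ℓ X → LEquiv ℓ X X) ×
    ((X Y : Graph) → LFinite ℓ X → LFinite ℓ Y → LEquiv ℓ X Y → LEquiv ℓ Y X) ×
    ((X Y Z : Graph) → LFinite ℓ X → LFinite ℓ Y → LFinite ℓ Z →
       LEquiv ℓ X Y → LEquiv ℓ Y Z → LEquiv ℓ X Z) ×
    ((X : Graph) → LFinite ℓ X →
       Σ Graph (λ M → LFinite ℓ M × LMinimal ℓ M × LEquiv ℓ M X ×
         ((M' : Graph) → LFinite ℓ M' → LMinimal ℓ M' → LEquiv ℓ M' X → M' ≅ M) ×
         ((Y : Graph) → LFinite ℓ Y → LEquiv ℓ Y X → InducedEmbedding (toS M) (toS Y))))
lemma1p2 em ℓ =
  (λ X _ → LEquiv-refl X) ,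
  (λ X Y _ _ → LEquiv-sym) ,
  (λ X Y Z → LEquiv-trans) ,
  -- the minimal representative of the class of X is its core
  λ X X-finite →
    core X ,
    LFinite-transfer {ℓ} {X} {core X} coreLinkIso X-finite ,
    core-minimal X ,
    (core X , idEmbedding (plain-setoidGraph (core X)) , coreInclusion ,
      idIso (link-setoidGraph ℓ (core X)) , coreLinkIso) ,
    -- a minimal M' is its own core, and equivalent graphs have isomorphic cores
    (λ M' M'-finite M'-minimal M'~X →
      composeIso (plain-setoidGraph (core X)) (equivalent-cores M'-finite X-finite M'~X)
        (all-linked-core M' (minimal-all-linked M' M'-finite M'-minimal))) ,
    -- the core of Y is induced in Y and isomorphic to the core of X
    λ Y Y-finite Y~X →
      induced-∘-iso {core X} {core Y} {Y} core-induced
        (inverseIso {core Y} {core X} (equivalent-cores Y-finite X-finite Y~X))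
  where open Core em ℓ
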